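{- Let $G$ be the disjoint union of two finite graphs $G_1$ and $G_2$ with $\alpha(G_1)=t_1$ and $\alpha(G_2)=t_2$. Then $f_G(t_1+t_2)\leq\max\{f_{G_1}(t_1),\ f_{G_2}(t_2)+t_1\}$.
   Context: $\alpha$ is the independence number. Given a family $A_1,\dots,A_m$ of (not necessarily distinct) subsets of the vertex set, a rainbow set of size $n$ is a set of $n$ distinct elements $\{a_{i_1},\dots,a_{i_n}\}$ with $1\leq i_1<\dots<i_n\leq m$ and $a_{i_j}\in A_{i_j}$; a rainbow independent set is a rainbow set that is independent in the graph. For a graph $H$ and integer $n\geq 1$, $f_H(n)$ is the minimum $t$ such that every collection of $t$ independent sets of size $n$ in $H$ has a rainbow independent set of size $n$. -}

module Defs where

open import Data.Nat using (ℕ; _≤_)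
open import Data.Bool using (Bool; true; false)
open import Data.Fin using (Fin; splitAt; _<_)
open import Data.Fin.Subset using (Subset; _∈_; ∣_∣)
open import Data.Sum using (_⊎_; inj₁; inj₂)
open import Data.Product using (Σ; _×_; ∃)
open import Function.Definitions using (Injective)
open import Relation.Binary.PropositionalEquality using (_≡_)
open import Relation.Nullary using (¬_)

record Graph : Set where
  field
    size   : ℕ
    adj    : Fin size → Fin size → Bool
    sym    : ∀ u v → adj u v ≡ adj v u
    irrefl : ∀ v → adj v v ≡ false
open Graph public

VSet : Graph → Set
VSet G = Subset (size G)

Independent : (G : Graph) → VSet G → Set
Independent G S = ∀ u v → u ∈ S → v ∈ S → adj G u v ≡ false

IndependenceNumber : Graph → ℕ → Set
IndependenceNumber G t =
  (Σ (VSet G) λ S → Independent G S × ∣ S ∣ ≡ t) ×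
  (∀ S → Independent G S → ∣ S ∣ ≤ t)

-- Disjoint union: vertices of G₁ are Fin n₁ embedded first, then those of G₂.
unionAdj : ∀ {n₁ n₂} → (Fin n₁ → Fin n₁ → Bool) → (Fin n₂ → Fin n₂ → Bool)
         → Fin n₁ ⊎ Fin n₂ → Fin n₁ ⊎ Fin n₂ → Bool
unionAdj a₁ a₂ (inj₁ u) (inj₁ v) = a₁ u v
unionAdj a₁ a₂ (inj₂ u) (inj₂ v) = a₂ u v
unionAdj a₁ a₂ (inj₁ u) (inj₂ v) = false
unionAdj a₁ a₂ (inj₂ u) (inj₁ v) = false

unionAdj-sym : ∀ {n₁ n₂} (a₁ : Fin n₁ → Fin n₁ → Bool) (a₂ : Fin n₂ → Fin n₂ → Bool)
  → (∀ u v → a₁ u v ≡ a₁ v u) → (∀ u v → a₂ u v ≡ a₂ v u)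
  → ∀ x y → unionAdj a₁ a₂ x y ≡ unionAdj a₁ a₂ y x
unionAdj-sym a₁ a₂ s₁ s₂ (inj₁ u) (inj₁ v) = s₁ u v
unionAdj-sym a₁ a₂ s₁ s₂ (inj₂ u) (inj₂ v) = s₂ u v
unionAdj-sym a₁ a₂ s₁ s₂ (inj₁ u) (inj₂ v) = Relation.Binary.PropositionalEquality.refl
unionAdj-sym a₁ a₂ s₁ s₂ (inj₂ u) (inj₁ v) = Relation.Binary.PropositionalEquality.refl

unionAdj-irrefl : ∀ {n₁ n₂} (a₁ : Fin n₁ → Fin n₁ → Bool) (a₂ : Fin n₂ → Fin n₂ → Bool)
  → (∀ v → a₁ v v ≡ false) → (∀ v → a₂ v v ≡ false)
  → ∀ x → unionAdj a₁ a₂ x x ≡ false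
unionAdj-irrefl a₁ a₂ i₁ i₂ (inj₁ v) = i₁ v
unionAdj-irrefl a₁ a₂ i₁ i₂ (inj₂ v) = i₂ v

disjointUnion : Graph → Graph → Graph
disjointUnion G₁ G₂ = record
  { size   = size G₁ Data.Nat.+ size G₂
  ; adj    = λ u v → unionAdj (adj G₁) (adj G₂) (splitAt (size G₁) u) (splitAt (size G₁) v)
  ; sym    = λ u v → unionAdj-sym (adj G₁) (adj G₂) (sym G₁) (sym G₂)
                       (splitAt (size G₁) u) (splitAt (size G₁) v)
  ; irrefl = λ v → unionAdj-irrefl (adj G₁) (adj G₂) (irrefl G₁) (irrefl G₂)
                       (splitAt (size G₁) v)
  }

Family : Graph → ℕ → Set
Family G m = Fin m → VSet G

RainbowIndependent : (G : Graph) {m : ℕ} → Family G m → ℕ → Set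
RainbowIndependent G {m} A n =
  Σ (Fin n → Fin m) λ idx →
  Σ (Fin n → Fin (size G)) λ a →
    (∀ j k → j < k → idx j < idx k) ×
    Injective _≡_ _≡_ a ×
    (∀ j → a j ∈ A (idx j)) ×
    (∀ j k → adj G (a j) (a k) ≡ false)

RainbowProperty : Graph → ℕ → ℕ → Set
RainbowProperty H n t =
  (A : Family H t) → (∀ i → Independent H (A i) × ∣ A i ∣ ≡ n) → RainbowIndependent H A n

IsF : Graph → ℕ → ℕ → Set
IsF H n t = RainbowProperty H n t × (∀ s → s Data.Nat.< t → ¬ RainbowProperty H n s)

{-# OPTIONS --safe #-}
module Submission where

-- Each independent set of size t₁ + t₂ in the union splits into independent parts in G₁ and G₂
-- of sizes at most t₁ and t₂, hence exactly t₁ and t₂. Among max{f₁, f₂ + t₁} such sets, the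
-- G₁-parts of the first f₁ contain a rainbow independent set occupying t₁ indices; at least f₂
-- indices remain, and their G₂-parts contain a rainbow independent set of size t₂. There are no
-- edges between G₁ and G₂, so the two together, with indices sorted, form the required set.

open import Defs
open import Data.Nat using (ℕ; zero; suc; s≤s; _+_; _≤_; _⊔_)
import Data.Nat.Properties as ℕP
open import Data.Bool using (true; false)
open import Data.Fin as F using (Fin; splitAt; join; _↑ˡ_; _↑ʳ_; inject≤; punchIn; punchOut)
open import Data.Fin.Properties as FP
  using ( 0≢1+n; splitAt-join; join-splitAt; inject≤-injective
        ; punchIn-injective; punchInᵢ≢i; punchOut-injective; punchIn-punchOut; ≤∧≢⇒<; <⇒≢)
open import Data.Fin.Subset using (Subset; _∈_; ∣_∣)
open import Data.Vec using (_∷_; take; drop; here; there)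
open import Data.Sum using (_⊎_; inj₁; inj₂; [_,_]′)
import Data.Sum as Sum
open import Data.Sum.Properties using (inj₁-injective; inj₂-injective)
open import Data.Product using (Σ; _×_; _,_; proj₁; proj₂)
open import Data.Empty using (⊥-elim)
open import Function using (_∘_)
open import Function.Definitions using (Injective)
open import Relation.Binary.PropositionalEquality using (_≡_; _≢_; refl; cong; trans)
import Relation.Binary.PropositionalEquality as Eq
open import Relation.Binary.Definitions using (tri<; tri≈; tri>)

private
  Inj : ∀ {A B : Set} → (A → B) → Set
  Inj = Injective _≡_ _≡_

StrictlyIncreasing : ∀ {n m} → (Fin n → Fin m) → Set
StrictlyIncreasing f = ∀ j k → j F.< k → f j F.< f k

strictlyIncreasing⇒injective : ∀ {n m} {f : Fin n → Fin m} → StrictlyIncreasing f → Inj f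
strictlyIncreasing⇒injective inc {j} {k} fj≡fk with FP.<-cmp j k
... | tri< j<k _ _ = ⊥-elim (<⇒≢ (inc j k j<k) fj≡fk)
... | tri≈ _ j≡k _ = j≡k
... | tri> _ _ k<j = ⊥-elim (<⇒≢ (inc k j k<j) (Eq.sym fj≡fk))

argmin : ∀ {n m} (f : Fin (suc n) → Fin m) → Σ (Fin (suc n)) λ i → ∀ j → f i F.≤ f j
argmin {zero} f = F.zero , λ { F.zero → FP.≤-refl }
argmin {suc n} f with argmin (f ∘ F.suc)
... | i , min with FP.≤-total (f F.zero) (f (F.suc i))
... | inj₁ f0≤ = F.zero , λ { F.zero → FP.≤-refl ; (F.suc j) → FP.≤-trans f0≤ (min j) }
... | inj₂ ≤f0 = F.suc i , λ { F.zero → ≤f0 ; (F.suc j) → min j }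

sortingPermutation : ∀ {n m} (f : Fin n → Fin m) → Inj f →
  Σ (Fin n → Fin n) λ σ → Inj σ × StrictlyIncreasing (f ∘ σ)
sortingPermutation {zero} f f-inj = (λ ()) , (λ { {()} }) , λ ()
sortingPermutation {suc n} f f-inj with argmin f
... | i , min with sortingPermutation (f ∘ punchIn i) (punchIn-injective i _ _ ∘ f-inj)
... | τ , τ-inj , τ-inc = σ , σ-inj , σ-inc
  where
  σ : Fin (suc n) → Fin (suc n)
  σ F.zero    = i
  σ (F.suc j) = punchIn i (τ j)

  σ-inj : Inj σ
  σ-inj {F.zero}  {F.zero}  _  = refl
  σ-inj {F.zero}  {F.suc k} eq = ⊥-elim (punchInᵢ≢i i (τ k) (Eq.sym eq))
  σ-inj {F.suc j} {F.zero}  eq = ⊥-elim (punchInᵢ≢i i (τ j) eq)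
  σ-inj {F.suc j} {F.suc k} eq = cong F.suc (τ-inj (punchIn-injective i _ _ eq))

  σ-inc : StrictlyIncreasing (f ∘ σ)
  σ-inc F.zero    (F.suc k) _         = ≤∧≢⇒< (min _) (punchInᵢ≢i i (τ k) ∘ Eq.sym ∘ f-inj)
  σ-inc (F.suc j) (F.suc k) (s≤s j<k) = τ-inc j k j<k

AvoidingInjection : ∀ {t M} → ℕ → (Fin t → Fin M) → Set
AvoidingInjection {M = M} f g = Σ (Fin f → Fin M) λ e → Inj e × (∀ k j → e k ≢ g j)

injection-avoiding : ∀ {t f M} (g : Fin t → Fin M) → Inj g → t + f ≤ M → AvoidingInjection f g
injection-avoiding {zero} g _ f≤M =
  (λ k → inject≤ k f≤M) , inject≤-injective f≤M f≤M _ _ , λ _ ()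
injection-avoiding {suc t} g g-inj (s≤s t+f≤M) = punchIn-g₀ (injection-avoiding g′ g′-inj t+f≤M)
  where
  g₀≢ : ∀ j → g F.zero ≢ g (F.suc j)
  g₀≢ j = 0≢1+n ∘ g-inj

  g′ : Fin t → Fin _
  g′ j = punchOut (g₀≢ j)

  g′-inj : Inj g′
  g′-inj {j} {k} eq = FP.suc-injective (g-inj (punchOut-injective (g₀≢ j) (g₀≢ k) eq))

  punchIn-g₀ : ∀ {f} → AvoidingInjection f g′ → AvoidingInjection f g
  punchIn-g₀ (e′ , e′-inj , e′-avoids) =
    punchIn (g F.zero) ∘ e′ , e′-inj ∘ punchIn-injective _ _ _ , avoids
    where
    avoids : ∀ k j → punchIn (g F.zero) (e′ k) ≢ g j
    avoids k F.zero       = punchInᵢ≢i _ (e′ k)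
    avoids k (F.suc j) eq =
      e′-avoids k j (punchIn-injective _ _ _ (trans eq (Eq.sym (punchIn-punchOut (g₀≢ j)))))

splitAt-injective : ∀ m {n} → Inj (splitAt m {n})
splitAt-injective m {n} {i} {j} eq =
  trans (Eq.sym (join-splitAt m n i)) (trans (cong (join m n) eq) (join-splitAt m n j))

join-injective : ∀ m n → Inj (join m n)
join-injective m n {i} {j} eq =
  trans (Eq.sym (splitAt-join m n i)) (trans (cong (splitAt m) eq) (splitAt-join m n j))

[,]-injective : ∀ {A B C : Set} {f : A → C} {g : B → C} → Inj f → Inj g →
  (∀ a b → f a ≢ g b) → Inj [ f , g ]′
[,]-injective f-inj g-inj f≢g {inj₁ a} {inj₁ a′} eq = cong inj₁ (f-inj eq)
[,]-injective f-inj g-inj f≢g {inj₁ a} {inj₂ b}  eq = ⊥-elim (f≢g a b eq)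
[,]-injective f-inj g-inj f≢g {inj₂ b} {inj₁ a}  eq = ⊥-elim (f≢g a b (Eq.sym eq))
[,]-injective f-inj g-inj f≢g {inj₂ b} {inj₂ b′} eq = cong inj₂ (g-inj eq)

map-injective : ∀ {A B C D : Set} {f : A → C} {g : B → D} → Inj f → Inj g → Inj (Sum.map f g)
map-injective f-inj g-inj {inj₁ a} {inj₁ a′} eq = cong inj₁ (f-inj (inj₁-injective eq))
map-injective f-inj g-inj {inj₂ b} {inj₂ b′} eq = cong inj₂ (g-inj (inj₂-injective eq))
map-injective f-inj g-inj {inj₁ a} {inj₂ b} ()
map-injective f-inj g-inj {inj₂ b} {inj₁ a} ()

∈-take⇒↑ˡ∈ : ∀ m {n} (S : Subset (m + n)) {u} → u ∈ take m S → u ↑ˡ n ∈ S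
∈-take⇒↑ˡ∈ (suc m) (x ∷ S) here        = here
∈-take⇒↑ˡ∈ (suc m) (x ∷ S) (there u∈S) = there (∈-take⇒↑ˡ∈ m S u∈S)

∈-drop⇒↑ʳ∈ : ∀ m {n} (S : Subset (m + n)) {v} → v ∈ drop m S → m ↑ʳ v ∈ S
∈-drop⇒↑ʳ∈ zero    S       v∈S = v∈S
∈-drop⇒↑ʳ∈ (suc m) (x ∷ S) v∈S = there (∈-drop⇒↑ʳ∈ m S v∈S)

∣take∣+∣drop∣ : ∀ m {n} (S : Subset (m + n)) → ∣ take m S ∣ + ∣ drop m S ∣ ≡ ∣ S ∣
∣take∣+∣drop∣ zero    S           = refl
∣take∣+∣drop∣ (suc m) (true ∷ S)  = cong suc (∣take∣+∣drop∣ m S)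
∣take∣+∣drop∣ (suc m) (false ∷ S) = ∣take∣+∣drop∣ m S

m≤o⇒n≤p⇒m+n≡o+p⇒m≡o×n≡p : ∀ {m n o p} → m ≤ o → n ≤ p → m + n ≡ o + p → m ≡ o × n ≡ p
m≤o⇒n≤p⇒m+n≡o+p⇒m≡o×n≡p {m} {n} {o} {p} m≤o n≤p eq =
  m≡o , ℕP.+-cancelˡ-≡ o n p (Eq.subst (λ x → x + n ≡ o + p) m≡o eq)
  where
  m≡o : m ≡ o
  m≡o = ℕP.≤-antisym m≤o (ℕP.+-cancelʳ-≤ p o m (Eq.subst (_≤ m + p) eq (ℕP.+-monoʳ-≤ m n≤p)))

-- A rainbow independent set whose indices need not be listed in increasing order.
record Rainbow (G : Graph) {m : ℕ} (A : Family G m) (n : ℕ) : Set where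
  field
    index            : Fin n → Fin m
    vertex           : Fin n → Fin (size G)
    index-injective  : Inj index
    vertex-injective : Inj vertex
    vertex∈          : ∀ j → vertex j ∈ A (index j)
    independent      : ∀ j k → adj G (vertex j) (vertex k) ≡ false
open Rainbow

rainbowIndependent⇒rainbow : ∀ {G m n} {A : Family G m} → RainbowIndependent G A n → Rainbow G A n
rainbowIndependent⇒rainbow (idx , a , idx-inc , a-inj , a∈ , a-indep) = record
  { index = idx ; vertex = a ; index-injective = strictlyIncreasing⇒injective idx-inc
  ; vertex-injective = a-inj ; vertex∈ = a∈ ; independent = a-indep }

rainbow⇒rainbowIndependent : ∀ {G m n} {A : Family G m} → Rainbow G A n → RainbowIndependent G A n
rainbow⇒rainbowIndependent R with sortingPermutation (index R) (index-injective R)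
... | σ , σ-inj , σ-inc =
  index R ∘ σ , vertex R ∘ σ , σ-inc , σ-inj ∘ vertex-injective R ,
  vertex∈ R ∘ σ , λ j k → independent R (σ j) (σ k)

reindex : ∀ {G k m n} {A : Family G m} (ρ : Fin k → Fin m) → Inj ρ →
  Rainbow G (A ∘ ρ) n → Rainbow G A n
reindex ρ ρ-inj R = record
  { index = ρ ∘ index R ; vertex = vertex R
  ; index-injective = index-injective R ∘ ρ-inj ; vertex-injective = vertex-injective R
  ; vertex∈ = vertex∈ R ; independent = independent R }

module DisjointUnion (G₁ G₂ : Graph) where

  G : Graph
  G = disjointUnion G₁ G₂

  left : VSet G → VSet G₁
  left = take (size G₁)

  right : VSet G → VSet G₂
  right = drop (size G₁)

  embed : Fin (size G₁) ⊎ Fin (size G₂) → Fin (size G)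
  embed = join (size G₁) (size G₂)

  adj-embed : ∀ x y → adj G (embed x) (embed y) ≡ unionAdj (adj G₁) (adj G₂) x y
  adj-embed x y rewrite splitAt-join (size G₁) (size G₂) x | splitAt-join (size G₁) (size G₂) y = refl

  left-independent : ∀ {S} → Independent G S → Independent G₁ (left S)
  left-independent {S} S-indep u v u∈ v∈ = trans (Eq.sym (adj-embed (inj₁ u) (inj₁ v)))
    (S-indep _ _ (∈-take⇒↑ˡ∈ (size G₁) S u∈) (∈-take⇒↑ˡ∈ (size G₁) S v∈))

  right-independent : ∀ {S} → Independent G S → Independent G₂ (right S)
  right-independent {S} S-indep u v u∈ v∈ = trans (Eq.sym (adj-embed (inj₂ u) (inj₂ v)))
    (S-indep _ _ (∈-drop⇒↑ʳ∈ (size G₁) S u∈) (∈-drop⇒↑ʳ∈ (size G₁) S v∈))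

  part-sizes : ∀ {t₁ t₂ S} → (∀ S₁ → Independent G₁ S₁ → ∣ S₁ ∣ ≤ t₁) →
    (∀ S₂ → Independent G₂ S₂ → ∣ S₂ ∣ ≤ t₂) → Independent G S → ∣ S ∣ ≡ t₁ + t₂ →
    ∣ left S ∣ ≡ t₁ × ∣ right S ∣ ≡ t₂
  part-sizes {S = S} α₁ α₂ S-indep ∣S∣≡ = m≤o⇒n≤p⇒m+n≡o+p⇒m≡o×n≡p
    (α₁ _ (left-independent S-indep)) (α₂ _ (right-independent S-indep))
    (trans (∣take∣+∣drop∣ (size G₁) S) ∣S∣≡)

  rainbow-join : ∀ {m n₁ n₂} {A : Family G m}
    (R₁ : Rainbow G₁ (left ∘ A) n₁) (R₂ : Rainbow G₂ (right ∘ A) n₂) →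
    (∀ j k → index R₁ j ≢ index R₂ k) → Rainbow G A (n₁ + n₂)
  rainbow-join {m} {n₁} {n₂} {A} R₁ R₂ disjoint = record
    { index = idx ∘ splitAt n₁
    ; vertex = embed ∘ vtx ∘ splitAt n₁
    ; index-injective = splitAt-injective n₁
                          ∘ [,]-injective (index-injective R₁) (index-injective R₂) disjoint
    ; vertex-injective = splitAt-injective n₁
                           ∘ map-injective (vertex-injective R₁) (vertex-injective R₂)
                           ∘ join-injective (size G₁) (size G₂)
    ; vertex∈ = vtx∈ ∘ splitAt n₁
    ; independent = λ j k → vtx-independent (splitAt n₁ j) (splitAt n₁ k)
    }
    where
    idx : Fin n₁ ⊎ Fin n₂ → Fin m
    idx = [ index R₁ , index R₂ ]′

    vtx : Fin n₁ ⊎ Fin n₂ → Fin (size G₁) ⊎ Fin (size G₂)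
    vtx = Sum.map (vertex R₁) (vertex R₂)

    vtx∈ : ∀ p → embed (vtx p) ∈ A (idx p)
    vtx∈ (inj₁ j) = ∈-take⇒↑ˡ∈ (size G₁) (A (index R₁ j)) (vertex∈ R₁ j)
    vtx∈ (inj₂ k) = ∈-drop⇒↑ʳ∈ (size G₁) (A (index R₂ k)) (vertex∈ R₂ k)

    vtx-independent : ∀ p q → adj G (embed (vtx p)) (embed (vtx q)) ≡ false
    vtx-independent p q rewrite adj-embed (vtx p) (vtx q) with p | q
    ... | inj₁ j | inj₁ k = independent R₁ j k
    ... | inj₁ j | inj₂ k = refl
    ... | inj₂ j | inj₁ k = refl
    ... | inj₂ j | inj₂ k = independent R₂ j k

  rainbowProperty : ∀ {t₁ t₂ f₁ f₂ m} →
    (∀ S₁ → Independent G₁ S₁ → ∣ S₁ ∣ ≤ t₁) → (∀ S₂ → Independent G₂ S₂ → ∣ S₂ ∣ ≤ t₂) →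
    f₁ ≤ m → t₁ + f₂ ≤ m → RainbowProperty G₁ t₁ f₁ → RainbowProperty G₂ t₂ f₂ →
    RainbowProperty G (t₁ + t₂) m
  rainbowProperty {t₁} {t₂} {f₁} {f₂} {m} α₁ α₂ f₁≤m t₁+f₂≤m rp₁ rp₂ A A-indep =
    rainbow⇒rainbowIndependent (rainbow-join R₁ R₂ λ j k → e-avoids (index R₂′ k) j ∘ Eq.sym)
    where
    sizes : ∀ i → ∣ left (A i) ∣ ≡ t₁ × ∣ right (A i) ∣ ≡ t₂
    sizes i = part-sizes α₁ α₂ (proj₁ (A-indep i)) (proj₂ (A-indep i))

    first : Fin f₁ → Fin m
    first i = inject≤ i f₁≤m

    R₁ : Rainbow G₁ (left ∘ A) t₁
    R₁ = reindex first (inject≤-injective f₁≤m f₁≤m _ _) (rainbowIndependent⇒rainbow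
           (rp₁ (left ∘ A ∘ first) λ i → left-independent (proj₁ (A-indep _)) , proj₁ (sizes _)))

    avoiding : AvoidingInjection f₂ (index R₁)
    avoiding = injection-avoiding (index R₁) (index-injective R₁) t₁+f₂≤m

    e : Fin f₂ → Fin m
    e = proj₁ avoiding

    e-avoids : ∀ k j → e k ≢ index R₁ j
    e-avoids = proj₂ (proj₂ avoiding)

    R₂′ : Rainbow G₂ (right ∘ A ∘ e) t₂
    R₂′ = rainbowIndependent⇒rainbow
            (rp₂ (right ∘ A ∘ e) λ i → right-independent (proj₁ (A-indep _)) , proj₂ (sizes _))

    R₂ : Rainbow G₂ (right ∘ A) t₂
    R₂ = reindex e (proj₁ (proj₂ avoiding)) R₂′

IsF⇒≤ : ∀ H {n t s} → IsF H n t → RainbowProperty H n s → t ≤ s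
IsF⇒≤ _ (_ , minimal) rp = ℕP.≮⇒≥ λ s<t → minimal _ s<t rp

proposition7p6 : (G₁ G₂ : Graph) (t₁ t₂ : ℕ)
    → IndependenceNumber G₁ t₁ → IndependenceNumber G₂ t₂
    → (fG f₁ f₂ : ℕ)
    → IsF (disjointUnion G₁ G₂) (t₁ + t₂) fG
    → IsF G₁ t₁ f₁ → IsF G₂ t₂ f₂
    → fG ≤ f₁ ⊔ (f₂ + t₁)
proposition7p6 G₁ G₂ t₁ t₂ α₁ α₂ fG f₁ f₂ isF isF₁ isF₂ =
  IsF⇒≤ (disjointUnion G₁ G₂) isF (DisjointUnion.rainbowProperty G₁ G₂ (proj₂ α₁) (proj₂ α₂)
    (ℕP.m≤m⊔n f₁ (f₂ + t₁))
    (Eq.subst (_≤ f₁ ⊔ (f₂ + t₁)) (ℕP.+-comm f₂ t₁) (ℕP.m≤n⊔m f₁ (f₂ + t₁)))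
    (proj₁ isF₁) (proj₁ isF₂))
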